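{- Let $A=\sum_{n=0}^\infty (-1)^{n(n+1)/2}q^{3n^2+2n}$ and $B=\sum_{n=-\infty}^{ -1}(-1)^{n(n+1)/2}q^{3n^2+2n}$, and define $b_3(n)$ by $\sum_{n=0}^\infty b_3(n)q^n=\frac{A^2B+AB^2}{(A+B)^4}$. Then for all $n\ge 0$: $$b_3(16n+15)\equiv 0\pmod 2,\quad b_3(64n+59)\equiv 0\pmod 2,\quad b_3(256n+235)\equiv 0\pmod 2.$$
   Context: $q$ is a complex variable with $|q|<1$ (or a formal variable); $A+B$ is a power series with constant term $1$, so the quotient is a power series with integer coefficients. -}

module Defs where

open import Data.Nat as ℕ using (ℕ; zero; suc; _∸_)
open import Data.Nat.DivMod using (_/_; _%_)
open import Data.Integer using (ℤ; +_; -_; _+_; _*_)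
open import Relation.Nullary using (yes; no)

Series : Set
Series = ℕ → ℤ

sumTo : ℕ → (ℕ → ℤ) → ℤ
sumTo zero    f = f zero
sumTo (suc m) f = sumTo m f + f (suc m)

_⊕_ : Series → Series → Series
(f ⊕ g) m = f m + g m

_⊗_ : Series → Series → Series
(f ⊗ g) m = sumTo m (λ i → f i * g (m ∸ i))

infixl 6 _⊕_
infixl 7 _⊗_

indic : ℕ → ℕ → ℤ → ℤ
indic k m c with k ℕ.≟ m
... | yes _ = c
... | no  _ = + 0

signPow : ℕ → ℤ
signPow k with k % 2 ℕ.≟ 0
... | yes _ = + 1
... | no  _ = - (+ 1)

-- A = Σ_{n ≥ 0} (-1)^{n(n+1)/2} q^{3n²+2n}.
-- The coefficient of q^m only receives terms with n ≤ m (since 3n²+2n ≥ n).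
A : Series
A m = sumTo m (λ n → indic (3 ℕ.* n ℕ.* n ℕ.+ 2 ℕ.* n) m (signPow ((n ℕ.* suc n) / 2)))

-- B = Σ_{n ≤ -1} (-1)^{n(n+1)/2} q^{3n²+2n}; write n = -k with k ≥ 1:
-- exponent 3k²-2k, sign (-1)^{k(k-1)/2}.  Terms with k ≤ m suffice (3k²-2k ≥ k).
B : Series
B m = sumTo m (λ k → indic (3 ℕ.* suc k ℕ.* suc k ∸ 2 ℕ.* suc k) m
                           (signPow ((suc k ℕ.* k) / 2)))

-- Multiplicative inverse of a series with constant term 1 (constant term of
-- f is ignored and taken to be 1).  approx m agrees with the inverse on
-- coefficients 0..m; inv f k = approx k k.
invApprox : Series → ℕ → Series
invApprox f zero    k with k ℕ.≟ 0
... | yes _ = + 1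
... | no  _ = + 0
invApprox f (suc m) k with k ℕ.≟ suc m
... | yes _ = - sumTo m (λ j → f (suc j) * invApprox f m (m ∸ j))
... | no  _ = invApprox f m k

inv : Series → Series
inv f k = invApprox f k k

b₃ : Series
b₃ = (A ⊗ A ⊗ B ⊕ A ⊗ B ⊗ B) ⊗ inv ((A ⊕ B) ⊗ (A ⊕ B) ⊗ (A ⊕ B) ⊗ (A ⊕ B))

-- Modulo 2 the signs disappear: A and B become the series of q^(3n²+2n) and q^(3n²+4n+1).
-- Since 3(2s+1)²+2(2s+1) = 4(3s²+4s+1)+1 and 3(2s)²+4(2s)+1 = 4(3s²+2s)+1, while all other
-- exponents are divisible by 4, we get A ≡ a(q⁴) + q·B(q⁴) and B ≡ b(q⁴) + q·A(q⁴).
-- Put C = AB and D = A + B. Dissecting products into even and odd parts shows that the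
-- coefficients of C vanish at 4n+3 and reproduce C at 4n+2, and that the coefficients of CD
-- at 4n+3 reproduce CD. As A²B + AB² = CD and D⁴ ≡ D(q⁴), extracting the coefficients at
-- 4n+3 from b₃·D(q⁴) ≡ CD gives D·(Σ b₃(4n+3)qⁿ) ≡ CD, so b₃(4n+3) ≡ c(n), where Σ c(n)qⁿ = C.
-- Hence b₃(16n+15) ≡ c(4n+3) ≡ 0, and c(4n+2) ≡ c(n) gives the other two congruences.
module Submission where

open import Defs
open import Data.Nat using (ℕ; _+_; _*_)
open import Data.Integer using (+_)
open import Data.Integer.Divisibility using (_∣_)
open import Data.Product using (_×_)

open import Data.Nat using (zero; suc; _∸_; _≤_; _<_; z≤n; s≤s; parity; _≟_)
open import Data.Nat.Properties
  using (≤-refl; m≤n⇒m≤1+n; +-suc; +-identityʳ; +-∸-assoc; m+n∸m≡n; ∸-+-assoc;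
         m+[n∸m]≡n; m∸[m∸n]≡n; n∸n≡0; m∸n≤m; ≤∧≢⇒<; m<1+n⇒m≤n;
         m≤n⇒m<n∨m≡n; <⇒≢; >⇒≢; <-trans; ≤-<-trans; <-cmp; <⇒≱;
         *-suc; *-assoc; +-comm; *-comm; *-cancelˡ-≡; +-cancelʳ-≡; m≤m+n; m+n∸n≡m)
open import Data.Nat.Tactic.RingSolver using (solve-∀)
open import Data.Nat.DivMod using (_/_; _%_; [m+kn]%n≡m%n; m<n⇒m%n≡m)
open import Data.Nat.Divisibility using (divides) renaming (_∣_ to _∣ℕ_)
open import Data.Integer as ℤ using (ℤ; -[1+_]; _⊖_; ∣_∣)
import Data.Integer.Properties as ℤ
open import Data.Parity.Base using (Parity; 0ℙ; 1ℙ) renaming (_+_ to _+ₚ_; _*_ to _*ₚ_)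
import Data.Parity.Properties as ℙ
open import Data.Product using (_,_; ∃-syntax; proj₂)
open import Data.Sum using (_⊎_; inj₁; inj₂)
open import Relation.Binary.Definitions using (tri<; tri≈; tri>)
open import Function using (_∘_)
open import Relation.Binary.PropositionalEquality
open import Relation.Nullary using (yes; no; contradiction)
import Relation.Binary.Reasoning.Setoid
open import Relation.Binary.Bundles using (Setoid)

-- Parity of integers

parityℤ : ℤ → Parity
parityℤ i = parity ∣ i ∣

parity-suc-+-suc : ∀ m n → parity (suc m) +ₚ parity (suc n) ≡ parity m +ₚ parity n
parity-suc-+-suc m n = begin
  parity (suc m) +ₚ parity (suc n) ≡⟨ ℙ.+-homo-+ (suc m) (suc n) ⟨
  parity (suc m + suc n)           ≡⟨ cong (parity ∘ suc) (+-suc m n) ⟩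
  parity (m + n)                   ≡⟨ ℙ.+-homo-+ m n ⟩
  parity m +ₚ parity n             ∎
  where open ≡-Reasoning

parityℤ-⊖ : ∀ m n → parityℤ (m ⊖ n) ≡ parity m +ₚ parity n
parityℤ-⊖ zero    zero    = refl
parityℤ-⊖ zero    (suc n) = refl
parityℤ-⊖ (suc m) zero    = sym (ℙ.+-identityʳ (parity (suc m)))
parityℤ-⊖ (suc m) (suc n) = begin
  parityℤ (suc m ⊖ suc n)          ≡⟨ cong parityℤ (ℤ.[1+m]⊖[1+n]≡m⊖n m n) ⟩
  parityℤ (m ⊖ n)                  ≡⟨ parityℤ-⊖ m n ⟩
  parity m +ₚ parity n             ≡⟨ parity-suc-+-suc m n ⟨
  parity (suc m) +ₚ parity (suc n) ∎
  where open ≡-Reasoning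

parityℤ-+ : ∀ i j → parityℤ (i ℤ.+ j) ≡ parityℤ i +ₚ parityℤ j
parityℤ-+ (+ m)    (+ n)    = ℙ.+-homo-+ m n
parityℤ-+ (+ m)    -[1+ n ] = parityℤ-⊖ m (suc n)
parityℤ-+ -[1+ m ] (+ n)    = trans (parityℤ-⊖ n (suc m)) (ℙ.+-comm (parity n) _)
parityℤ-+ -[1+ m ] -[1+ n ] = trans (ℙ.+-homo-+ m n) (sym (parity-suc-+-suc m n))

parityℤ-* : ∀ i j → parityℤ (i ℤ.* j) ≡ parityℤ i *ₚ parityℤ j
parityℤ-* i j = trans (cong parity (ℤ.abs-* i j)) (ℙ.*-homo-* ∣ i ∣ ∣ j ∣)

parityℤ-neg : ∀ i → parityℤ (ℤ.- i) ≡ parityℤ i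
parityℤ-neg i = cong parity (ℤ.∣-i∣≡∣i∣ i)

parity≡0ℙ⇒2∣ : ∀ n → parity n ≡ 0ℙ → 2 ∣ℕ n
parity≡0ℙ⇒2∣ zero          _  = divides 0 refl
parity≡0ℙ⇒2∣ (suc zero)    ()
parity≡0ℙ⇒2∣ (suc (suc n)) eq with divides k n≡k*2 ← parity≡0ℙ⇒2∣ n eq =
  divides (suc k) (cong (suc ∘ suc) n≡k*2)

-- Power series modulo 2

Series₂ : Set
Series₂ = ℕ → Parity

sumTo₂ : ℕ → (ℕ → Parity) → Parity
sumTo₂ zero    f = f zero
sumTo₂ (suc m) f = sumTo₂ m f +ₚ f (suc m)

infixl 6 _⊕₂_
infixl 7 _⊗₂_

_⊕₂_ : Series₂ → Series₂ → Series₂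
(F ⊕₂ G) m = F m +ₚ G m

_⊗₂_ : Series₂ → Series₂ → Series₂
(F ⊗₂ G) m = sumTo₂ m (λ i → F i *ₚ G (m ∸ i))

0₂ 1₂ : Series₂
0₂ _       = 0ℙ
1₂ zero    = 1ℙ
1₂ (suc _) = 0ℙ

sumTo₂-cong : ∀ m {f g} → (∀ i → i ≤ m → f i ≡ g i) → sumTo₂ m f ≡ sumTo₂ m g
sumTo₂-cong zero    f≡g = f≡g 0 z≤n
sumTo₂-cong (suc m) f≡g =
  cong₂ _+ₚ_ (sumTo₂-cong m (λ i i≤m → f≡g i (m≤n⇒m≤1+n i≤m))) (f≡g (suc m) ≤-refl)

sumTo₂-+ : ∀ m f g → sumTo₂ m (λ i → f i +ₚ g i) ≡ sumTo₂ m f +ₚ sumTo₂ m g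
sumTo₂-+ zero    f g = refl
sumTo₂-+ (suc m) f g = trans (cong (_+ₚ (f (suc m) +ₚ g (suc m))) (sumTo₂-+ m f g))
                             (interchange (sumTo₂ m f) (sumTo₂ m g) (f (suc m)) (g (suc m)))
  where open import Algebra.Properties.CommutativeSemigroup ℙ.+-commutativeSemigroup using (interchange)

sumTo₂-*ˡ : ∀ m c f → sumTo₂ m (λ i → c *ₚ f i) ≡ c *ₚ sumTo₂ m f
sumTo₂-*ˡ zero    c f = refl
sumTo₂-*ˡ (suc m) c f = trans (cong (_+ₚ (c *ₚ f (suc m))) (sumTo₂-*ˡ m c f))
                              (sym (ℙ.*-distribˡ-+ c (sumTo₂ m f) (f (suc m))))

sumTo₂-*ʳ : ∀ m c f → sumTo₂ m (λ i → f i *ₚ c) ≡ sumTo₂ m f *ₚ c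
sumTo₂-*ʳ zero    c f = refl
sumTo₂-*ʳ (suc m) c f = trans (cong (_+ₚ (f (suc m) *ₚ c)) (sumTo₂-*ʳ m c f))
                              (sym (ℙ.*-distribʳ-+ c (sumTo₂ m f) (f (suc m))))

sumTo₂-0ℙ : ∀ m f → (∀ i → i ≤ m → f i ≡ 0ℙ) → sumTo₂ m f ≡ 0ℙ
sumTo₂-0ℙ m f f≡0 = trans (sumTo₂-cong m f≡0) (zeros m)
  where
  zeros : ∀ m → sumTo₂ m (λ _ → 0ℙ) ≡ 0ℙ
  zeros zero    = refl
  zeros (suc m) = trans (ℙ.+-identityʳ _) (zeros m)

sumTo₂-unconsˡ : ∀ m f → sumTo₂ (suc m) f ≡ f 0 +ₚ sumTo₂ m (f ∘ suc)
sumTo₂-unconsˡ zero    f = refl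
sumTo₂-unconsˡ (suc m) f = trans (cong (_+ₚ f (suc (suc m))) (sumTo₂-unconsˡ m f))
                                 (ℙ.+-assoc (f 0) (sumTo₂ m (f ∘ suc)) (f (suc (suc m))))

suc-∸ : ∀ {m n} → n ≤ m → suc m ∸ n ≡ suc (m ∸ n)
suc-∸ = +-∸-assoc 1

sumTo₂-reverse : ∀ m f → sumTo₂ m f ≡ sumTo₂ m (λ i → f (m ∸ i))
sumTo₂-reverse zero    f = refl
sumTo₂-reverse (suc m) f = begin
  sumTo₂ m f +ₚ f (suc m)                  ≡⟨ cong (_+ₚ f (suc m)) (sumTo₂-reverse m f) ⟩
  sumTo₂ m (λ i → f (m ∸ i)) +ₚ f (suc m)  ≡⟨ ℙ.+-comm _ (f (suc m)) ⟩
  f (suc m) +ₚ sumTo₂ m (λ i → f (m ∸ i))  ≡⟨ sumTo₂-unconsˡ m (λ i → f (suc m ∸ i)) ⟨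
  sumTo₂ (suc m) (λ i → f (suc m ∸ i))     ∎
  where open ≡-Reasoning

sumTo₂-swap : ∀ m (T : ℕ → ℕ → Parity) →
  sumTo₂ m (λ i → sumTo₂ i (λ j → T j i)) ≡ sumTo₂ m (λ j → sumTo₂ (m ∸ j) (λ k → T j (j + k)))
sumTo₂-swap zero    T = refl
sumTo₂-swap (suc m) T = begin
  sumTo₂ m (λ i → sumTo₂ i (λ j → T j i)) +ₚ (sumTo₂ m (λ j → T j (suc m)) +ₚ T (suc m) (suc m))
    ≡⟨ cong (_+ₚ (sumTo₂ m (λ j → T j (suc m)) +ₚ T (suc m) (suc m))) (sumTo₂-swap m T) ⟩
  Rows m +ₚ (sumTo₂ m (λ j → T j (suc m)) +ₚ T (suc m) (suc m))
    ≡⟨ ℙ.+-assoc (Rows m) _ _ ⟨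
  (Rows m +ₚ sumTo₂ m (λ j → T j (suc m))) +ₚ T (suc m) (suc m)
    ≡⟨ cong₂ _+ₚ_ (sym (sumTo₂-+ m _ _)) (cong (T (suc m)) (sym (+-identityʳ (suc m)))) ⟩
  sumTo₂ m (λ j → sumTo₂ (m ∸ j) (λ k → T j (j + k)) +ₚ T j (suc m)) +ₚ T (suc m) (suc m + 0)
    ≡⟨ cong₂ _+ₚ_ (sumTo₂-cong m (λ j j≤m → sym (row j j≤m)))
                  (cong (λ l → sumTo₂ l (λ k → T (suc m) (suc m + k))) (sym (n∸n≡0 m))) ⟩
  sumTo₂ (suc m) (λ j → sumTo₂ (suc m ∸ j) (λ k → T j (j + k))) ∎
  where
  open ≡-Reasoning
  Rows : ℕ → Parity
  Rows m = sumTo₂ m (λ j → sumTo₂ (m ∸ j) (λ k → T j (j + k)))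
  row : ∀ j → j ≤ m →
    sumTo₂ (suc m ∸ j) (λ k → T j (j + k)) ≡ sumTo₂ (m ∸ j) (λ k → T j (j + k)) +ₚ T j (suc m)
  row j j≤m rewrite suc-∸ j≤m = cong (λ l → sumTo₂ (m ∸ j) (λ k → T j (j + k)) +ₚ T j l)
                                     (trans (+-suc j (m ∸ j)) (cong suc (m+[n∸m]≡n j≤m)))

module ≗-Reasoning = Relation.Binary.Reasoning.Setoid (ℕ →-setoid Parity)

open Setoid (ℕ →-setoid Parity) using () renaming (trans to ≗-trans)

⊕₂-cong : ∀ {F F′ G G′} → F ≗ F′ → G ≗ G′ → F ⊕₂ G ≗ F′ ⊕₂ G′
⊕₂-cong F≗F′ G≗G′ m = cong₂ _+ₚ_ (F≗F′ m) (G≗G′ m)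

⊗₂-cong : ∀ {F F′ G G′} → F ≗ F′ → G ≗ G′ → F ⊗₂ G ≗ F′ ⊗₂ G′
⊗₂-cong F≗F′ G≗G′ m = sumTo₂-cong m (λ i _ → cong₂ _*ₚ_ (F≗F′ i) (G≗G′ (m ∸ i)))

⊕₂-congˡ : ∀ F {G G′} → G ≗ G′ → F ⊕₂ G ≗ F ⊕₂ G′
⊕₂-congˡ F {G} = ⊕₂-cong {F} {F} {G} (λ _ → refl)

⊗₂-congˡ : ∀ F {G G′} → G ≗ G′ → F ⊗₂ G ≗ F ⊗₂ G′
⊗₂-congˡ F {G} = ⊗₂-cong {F} {F} {G} (λ _ → refl)

⊗₂-congʳ : ∀ G {F F′} → F ≗ F′ → F ⊗₂ G ≗ F′ ⊗₂ G
⊗₂-congʳ G F≗F′ = ⊗₂-cong {G = G} F≗F′ (λ _ → refl)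

⊕₂-comm : ∀ F G → F ⊕₂ G ≗ G ⊕₂ F
⊕₂-comm F G m = ℙ.+-comm (F m) (G m)

⊕₂-identityʳ : ∀ F → F ⊕₂ 0₂ ≗ F
⊕₂-identityʳ F m = ℙ.+-identityʳ (F m)

⊗₂-comm : ∀ F G → F ⊗₂ G ≗ G ⊗₂ F
⊗₂-comm F G m = trans (sumTo₂-reverse m _) (sumTo₂-cong m λ i i≤m →
  trans (ℙ.*-comm (F (m ∸ i)) _) (cong (λ j → G j *ₚ F (m ∸ i)) (m∸[m∸n]≡n i≤m)))

⊗₂-assoc : ∀ F G H → (F ⊗₂ G) ⊗₂ H ≗ F ⊗₂ (G ⊗₂ H)
⊗₂-assoc F G H m = begin
  sumTo₂ m (λ i → sumTo₂ i (λ j → F j *ₚ G (i ∸ j)) *ₚ H (m ∸ i))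
    ≡⟨ sumTo₂-cong m (λ i _ → sym (sumTo₂-*ʳ i (H (m ∸ i)) _)) ⟩
  sumTo₂ m (λ i → sumTo₂ i (λ j → (F j *ₚ G (i ∸ j)) *ₚ H (m ∸ i)))
    ≡⟨ sumTo₂-swap m (λ j i → (F j *ₚ G (i ∸ j)) *ₚ H (m ∸ i)) ⟩
  sumTo₂ m (λ j → sumTo₂ (m ∸ j) (λ k → (F j *ₚ G (j + k ∸ j)) *ₚ H (m ∸ (j + k))))
    ≡⟨ sumTo₂-cong m (λ j _ → trans (sumTo₂-cong (m ∸ j) (λ k _ → reassociate j k))
                                    (sumTo₂-*ˡ (m ∸ j) (F j) _)) ⟩
  sumTo₂ m (λ j → F j *ₚ sumTo₂ (m ∸ j) (λ k → G k *ₚ H (m ∸ j ∸ k))) ∎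
  where
  open ≡-Reasoning
  reassociate : ∀ j k → (F j *ₚ G (j + k ∸ j)) *ₚ H (m ∸ (j + k)) ≡ F j *ₚ (G k *ₚ H (m ∸ j ∸ k))
  reassociate j k = trans (ℙ.*-assoc (F j) _ _)
    (cong₂ (λ a b → F j *ₚ (G a *ₚ H b)) (m+n∸m≡n j k) (sym (∸-+-assoc m j k)))

⊗₂-distribʳ-⊕₂ : ∀ F G H → (F ⊕₂ G) ⊗₂ H ≗ F ⊗₂ H ⊕₂ G ⊗₂ H
⊗₂-distribʳ-⊕₂ F G H m =
  trans (sumTo₂-cong m (λ i _ → ℙ.*-distribʳ-+ (H (m ∸ i)) (F i) (G i))) (sumTo₂-+ m _ _)

⊗₂-identityˡ : ∀ F → 1₂ ⊗₂ F ≗ F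
⊗₂-identityˡ F zero    = refl
⊗₂-identityˡ F (suc m) = trans (sumTo₂-unconsˡ m _)
  (trans (cong (F (suc m) +ₚ_) (sumTo₂-0ℙ m _ (λ _ _ → refl))) (ℙ.+-identityʳ (F (suc m))))

⊗₂-identityʳ : ∀ F → F ⊗₂ 1₂ ≗ F
⊗₂-identityʳ F m = trans (⊗₂-comm F 1₂ m) (⊗₂-identityˡ F m)

⊗₂-zeroʳ : ∀ F {G} → G ≗ 0₂ → F ⊗₂ G ≗ 0₂
⊗₂-zeroʳ F G≗0 m = sumTo₂-0ℙ m _ (λ i _ → trans (cong (F i *ₚ_) (G≗0 (m ∸ i))) (ℙ.*-zeroʳ (F i)))

⊗₂-zeroˡ : ∀ G {F} → F ≗ 0₂ → F ⊗₂ G ≗ 0₂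
⊗₂-zeroˡ G {F} F≗0 = ≗-trans (⊗₂-comm F G) (⊗₂-zeroʳ G F≗0)

-- Even and odd parts

double : ℕ → ℕ
double zero    = zero
double (suc n) = suc (suc (double n))

evenPart oddPart dilate shift : Series₂ → Series₂
evenPart F k = F (double k)
oddPart  F k = F (suc (double k))
-- dilate F = F(q²) and shift F = q·F
dilate F zero          = F zero
dilate F (suc zero)    = 0ℙ
dilate F (suc (suc m)) = dilate (F ∘ suc) m
shift F zero    = 0ℙ
shift F (suc m) = F m

evenPart-dilate : ∀ F → evenPart (dilate F) ≗ F
evenPart-dilate F zero    = refl
evenPart-dilate F (suc k) = evenPart-dilate (F ∘ suc) k

oddPart-dilate : ∀ F → oddPart (dilate F) ≗ 0₂
oddPart-dilate F zero    = refl
oddPart-dilate F (suc k) = oddPart-dilate (F ∘ suc) k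

dilate-⊕₂ : ∀ F G → dilate (F ⊕₂ G) ≗ dilate F ⊕₂ dilate G
dilate-⊕₂ F G zero          = refl
dilate-⊕₂ F G (suc zero)    = refl
dilate-⊕₂ F G (suc (suc m)) = dilate-⊕₂ (F ∘ suc) (G ∘ suc) m

evenPart-shift : ∀ F → evenPart (shift F) ≗ shift (oddPart F)
evenPart-shift F zero    = refl
evenPart-shift F (suc k) = refl

≗-byParts : ∀ {F G} → evenPart F ≗ evenPart G → oddPart F ≗ oddPart G → F ≗ G
≗-byParts {F} {G} ev≗ od≗ zero          = ev≗ 0
≗-byParts {F} {G} ev≗ od≗ (suc zero)    = od≗ 0
≗-byParts {F} {G} ev≗ od≗ (suc (suc m)) =
  ≗-byParts {F ∘ suc ∘ suc} {G ∘ suc ∘ suc} (ev≗ ∘ suc) (od≗ ∘ suc) m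

dissection : ∀ F → F ≗ dilate (evenPart F) ⊕₂ shift (dilate (oddPart F))
dissection F = ≗-byParts
  (λ k → sym (trans (⊕₂-cong (evenPart-dilate (evenPart F)) (evenPart-shift (dilate (oddPart F))) k)
                    (trans (cong (F (double k) +ₚ_) (shift-oddPart-dilate k)) (ℙ.+-identityʳ _))))
  (λ k → sym (⊕₂-cong (oddPart-dilate (evenPart F)) (evenPart-dilate (oddPart F)) k))
  where
  shift-oddPart-dilate : shift (oddPart (dilate (oddPart F))) ≗ 0₂
  shift-oddPart-dilate zero    = refl
  shift-oddPart-dilate (suc k) = oddPart-dilate (oddPart F) k

sumTo₂-unconsˡ² : ∀ m f → sumTo₂ (suc (suc m)) f ≡ f 0 +ₚ (f 1 +ₚ sumTo₂ m (f ∘ suc ∘ suc))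
sumTo₂-unconsˡ² m f = trans (sumTo₂-unconsˡ (suc m) f) (cong (f 0 +ₚ_) (sumTo₂-unconsˡ m (f ∘ suc)))

sumTo₂-dilate : ∀ k (F T : Series₂) →
  sumTo₂ (double k) (λ i → dilate F i *ₚ T i) ≡ sumTo₂ k (λ j → F j *ₚ T (double j))
sumTo₂-dilate zero    F T = refl
sumTo₂-dilate (suc k) F T = begin
  sumTo₂ (double (suc k)) (λ i → dilate F i *ₚ T i)
    ≡⟨ sumTo₂-unconsˡ² (double k) (λ i → dilate F i *ₚ T i) ⟩
  (F 0 *ₚ T 0) +ₚ sumTo₂ (double k) (λ i → dilate (F ∘ suc) i *ₚ T (suc (suc i)))
    ≡⟨ cong ((F 0 *ₚ T 0) +ₚ_) (sumTo₂-dilate k (F ∘ suc) (T ∘ suc ∘ suc)) ⟩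
  (F 0 *ₚ T 0) +ₚ sumTo₂ k (λ j → F (suc j) *ₚ T (double (suc j)))
    ≡⟨ sumTo₂-unconsˡ k (λ j → F j *ₚ T (double j)) ⟨
  sumTo₂ (suc k) (λ j → F j *ₚ T (double j)) ∎
  where open ≡-Reasoning

double-∸ : ∀ k j → double k ∸ double j ≡ double (k ∸ j)
double-∸ zero    zero    = refl
double-∸ zero    (suc j) = refl
double-∸ (suc k) zero    = refl
double-∸ (suc k) (suc j) = double-∸ k j

suc-double-∸ : ∀ {k j} → j ≤ k → suc (double k) ∸ double j ≡ suc (double (k ∸ j))
suc-double-∸ z≤n       = refl
suc-double-∸ (s≤s j≤k) = suc-double-∸ j≤k

evenPart-dilate-⊗₂ : ∀ F H → evenPart (dilate F ⊗₂ H) ≗ F ⊗₂ evenPart H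
evenPart-dilate-⊗₂ F H k = trans (sumTo₂-dilate k F (λ i → H (double k ∸ i)))
  (sumTo₂-cong k (λ j _ → cong (λ i → F j *ₚ H i) (double-∸ k j)))

oddPart-dilate-⊗₂ : ∀ F H → oddPart (dilate F ⊗₂ H) ≗ F ⊗₂ oddPart H
oddPart-dilate-⊗₂ F H k = begin
  sumTo₂ (double k) T +ₚ (dilate F (suc (double k)) *ₚ H (suc (double k) ∸ suc (double k)))
    ≡⟨ cong (λ c → sumTo₂ (double k) T +ₚ (c *ₚ _)) (oddPart-dilate F k) ⟩
  sumTo₂ (double k) T +ₚ 0ℙ
    ≡⟨ ℙ.+-identityʳ _ ⟩
  sumTo₂ (double k) T
    ≡⟨ sumTo₂-dilate k F (λ i → H (suc (double k) ∸ i)) ⟩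
  sumTo₂ k (λ j → F j *ₚ H (suc (double k) ∸ double j))
    ≡⟨ sumTo₂-cong k (λ j j≤k → cong (λ i → F j *ₚ H i) (suc-double-∸ j≤k)) ⟩
  (F ⊗₂ oddPart H) k ∎
  where
  open ≡-Reasoning
  T : ℕ → Parity
  T i = dilate F i *ₚ H (suc (double k) ∸ i)

evenPart-cong : ∀ {F G} → F ≗ G → evenPart F ≗ evenPart G
evenPart-cong F≗G = F≗G ∘ double

oddPart-cong : ∀ {F G} → F ≗ G → oddPart F ≗ oddPart G
oddPart-cong F≗G = F≗G ∘ suc ∘ double

shift-cong : ∀ {F G} → F ≗ G → shift F ≗ shift G
shift-cong F≗G zero    = refl
shift-cong F≗G (suc m) = F≗G m

shift-⊗₂ : ∀ F G → shift F ⊗₂ G ≗ shift (F ⊗₂ G)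
shift-⊗₂ F G zero    = refl
shift-⊗₂ F G (suc m) = sumTo₂-unconsˡ m _

evenPart-⊗₂ : ∀ F G → evenPart (F ⊗₂ G) ≗ evenPart F ⊗₂ evenPart G ⊕₂ shift (oddPart F ⊗₂ oddPart G)
evenPart-⊗₂ F G = begin
  evenPart (F ⊗₂ G)
    ≈⟨ evenPart-cong (⊗₂-congʳ G (dissection F)) ⟩
  evenPart ((dilate (evenPart F) ⊕₂ shift (dilate (oddPart F))) ⊗₂ G)
    ≈⟨ evenPart-cong (⊗₂-distribʳ-⊕₂ _ _ G) ⟩
  evenPart (dilate (evenPart F) ⊗₂ G) ⊕₂ evenPart (shift (dilate (oddPart F)) ⊗₂ G)
    ≈⟨ ⊕₂-cong (evenPart-dilate-⊗₂ (evenPart F) G) (evenPart-cong (shift-⊗₂ _ G)) ⟩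
  evenPart F ⊗₂ evenPart G ⊕₂ evenPart (shift (dilate (oddPart F) ⊗₂ G))
    ≈⟨ ⊕₂-congˡ (evenPart F ⊗₂ evenPart G) (evenPart-shift _) ⟩
  evenPart F ⊗₂ evenPart G ⊕₂ shift (oddPart (dilate (oddPart F) ⊗₂ G))
    ≈⟨ ⊕₂-congˡ (evenPart F ⊗₂ evenPart G) (shift-cong (oddPart-dilate-⊗₂ (oddPart F) G)) ⟩
  evenPart F ⊗₂ evenPart G ⊕₂ shift (oddPart F ⊗₂ oddPart G) ∎
  where open ≗-Reasoning

oddPart-⊗₂ : ∀ F G → oddPart (F ⊗₂ G) ≗ evenPart F ⊗₂ oddPart G ⊕₂ oddPart F ⊗₂ evenPart G
oddPart-⊗₂ F G = begin
  oddPart (F ⊗₂ G)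
    ≈⟨ oddPart-cong (⊗₂-congʳ G (dissection F)) ⟩
  oddPart ((dilate (evenPart F) ⊕₂ shift (dilate (oddPart F))) ⊗₂ G)
    ≈⟨ oddPart-cong (⊗₂-distribʳ-⊕₂ _ _ G) ⟩
  oddPart (dilate (evenPart F) ⊗₂ G) ⊕₂ oddPart (shift (dilate (oddPart F)) ⊗₂ G)
    ≈⟨ ⊕₂-cong (oddPart-dilate-⊗₂ (evenPart F) G) (oddPart-cong (shift-⊗₂ _ G)) ⟩
  evenPart F ⊗₂ oddPart G ⊕₂ evenPart (dilate (oddPart F) ⊗₂ G)
    ≈⟨ ⊕₂-congˡ (evenPart F ⊗₂ oddPart G) (evenPart-dilate-⊗₂ (oddPart F) G) ⟩
  evenPart F ⊗₂ oddPart G ⊕₂ oddPart F ⊗₂ evenPart G ∎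
  where open ≗-Reasoning

Palindromic : ℕ → (ℕ → Parity) → Set
Palindromic m f = ∀ i → i ≤ m → f i ≡ f (m ∸ i)

sumTo₂-palindromic-trim : ∀ m f → Palindromic (suc (suc m)) f →
  sumTo₂ (suc (suc m)) f ≡ sumTo₂ m (f ∘ suc) × Palindromic m (f ∘ suc)
sumTo₂-palindromic-trim m f pal = trimmed , λ i i≤m →
  trans (pal (suc i) (s≤s (m≤n⇒m≤1+n i≤m))) (cong f (suc-∸ i≤m))
  where
  trimmed : sumTo₂ (suc (suc m)) f ≡ sumTo₂ m (f ∘ suc)
  trimmed = begin
    sumTo₂ (suc m) f +ₚ f (suc (suc m))          ≡⟨ cong₂ _+ₚ_ (sumTo₂-unconsˡ m f) (sym (pal 0 z≤n)) ⟩
    (f 0 +ₚ sumTo₂ m (f ∘ suc)) +ₚ f 0           ≡⟨ cong (_+ₚ f 0) (ℙ.+-comm (f 0) _) ⟩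
    (sumTo₂ m (f ∘ suc) +ₚ f 0) +ₚ f 0           ≡⟨ ℙ.+-assoc (sumTo₂ m (f ∘ suc)) (f 0) (f 0) ⟩
    sumTo₂ m (f ∘ suc) +ₚ (f 0 +ₚ f 0)           ≡⟨ cong (sumTo₂ m (f ∘ suc) +ₚ_) (ℙ.p+p≡0ℙ (f 0)) ⟩
    sumTo₂ m (f ∘ suc) +ₚ 0ℙ                     ≡⟨ ℙ.+-identityʳ _ ⟩
    sumTo₂ m (f ∘ suc)                           ∎
    where open ≡-Reasoning

sumTo₂-palindromic-even : ∀ k f → Palindromic (double k) f → sumTo₂ (double k) f ≡ f k
sumTo₂-palindromic-even zero    f pal = refl
sumTo₂-palindromic-even (suc k) f pal with eq , pal′ ← sumTo₂-palindromic-trim (double k) f pal =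
  trans eq (sumTo₂-palindromic-even k (f ∘ suc) pal′)

sumTo₂-palindromic-odd : ∀ k f → Palindromic (suc (double k)) f → sumTo₂ (suc (double k)) f ≡ 0ℙ
sumTo₂-palindromic-odd zero    f pal = trans (cong (_+ₚ f 1) (pal 0 z≤n)) (ℙ.p+p≡0ℙ (f 1))
sumTo₂-palindromic-odd (suc k) f pal with eq , pal′ ← sumTo₂-palindromic-trim (suc (double k)) f pal =
  trans eq (sumTo₂-palindromic-odd k (f ∘ suc) pal′)

double∸n≡n : ∀ n → double n ∸ n ≡ n
double∸n≡n zero    = refl
double∸n≡n (suc n) = trans (suc-∸ (n≤double n)) (cong suc (double∸n≡n n))
  where
  n≤double : ∀ n → n ≤ double n
  n≤double zero    = z≤n
  n≤double (suc n) = s≤s (m≤n⇒m≤1+n (n≤double n))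

⊗₂-square : ∀ F → F ⊗₂ F ≗ dilate F
⊗₂-square F = ≗-byParts
  (λ k → begin
    sumTo₂ (double k) (λ i → F i *ₚ F (double k ∸ i))
      ≡⟨ sumTo₂-palindromic-even k _ (square-palindromic (double k)) ⟩
    F k *ₚ F (double k ∸ k)                           ≡⟨ cong (F k *ₚ_) (cong F (double∸n≡n k)) ⟩
    F k *ₚ F k                                        ≡⟨ ℙ.*-idem (F k) ⟩
    F k                                               ≡⟨ evenPart-dilate F k ⟨
    dilate F (double k)                               ∎)
  (λ k → trans (sumTo₂-palindromic-odd k _ (square-palindromic (suc (double k))))
               (sym (oddPart-dilate F k)))
  where
  open ≡-Reasoning
  square-palindromic : ∀ m → Palindromic m (λ i → F i *ₚ F (m ∸ i))
  square-palindromic m i i≤m =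
    trans (ℙ.*-comm (F i) _) (cong (λ j → F (m ∸ i) *ₚ F j) (sym (m∸[m∸n]≡n i≤m)))

⊗₂-fourth-power : ∀ F → F ⊗₂ F ⊗₂ F ⊗₂ F ≗ dilate (dilate F)
⊗₂-fourth-power F = begin
  F ⊗₂ F ⊗₂ F ⊗₂ F          ≈⟨ ⊗₂-assoc (F ⊗₂ F) F F ⟩
  (F ⊗₂ F) ⊗₂ (F ⊗₂ F)      ≈⟨ ⊗₂-cong (⊗₂-square F) (⊗₂-square F) ⟩
  dilate F ⊗₂ dilate F      ≈⟨ ⊗₂-square (dilate F) ⟩
  dilate (dilate F)         ∎
  where open ≗-Reasoning

x²y+xy²≗xy[x+y] : ∀ X Y → X ⊗₂ X ⊗₂ Y ⊕₂ X ⊗₂ Y ⊗₂ Y ≗ (X ⊗₂ Y) ⊗₂ (X ⊕₂ Y)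
x²y+xy²≗xy[x+y] X Y = begin
  X ⊗₂ X ⊗₂ Y ⊕₂ X ⊗₂ Y ⊗₂ Y                ≈⟨ ⊕₂-cong (⊗₂-assoc X X Y) (⊗₂-comm (X ⊗₂ Y) Y) ⟩
  X ⊗₂ (X ⊗₂ Y) ⊕₂ Y ⊗₂ (X ⊗₂ Y)            ≈⟨ ⊗₂-distribʳ-⊕₂ X Y (X ⊗₂ Y) ⟨
  (X ⊕₂ Y) ⊗₂ (X ⊗₂ Y)                      ≈⟨ ⊗₂-comm (X ⊕₂ Y) (X ⊗₂ Y) ⟩
  (X ⊗₂ Y) ⊗₂ (X ⊕₂ Y)                      ∎
  where open ≗-Reasoning

-- Inverses

-- invApprox of Defs read modulo 2, where negation is the identity
inv₂Approx : Series₂ → ℕ → Series₂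
inv₂Approx F zero    k with k ≟ 0
... | yes _ = 1ℙ
... | no  _ = 0ℙ
inv₂Approx F (suc m) k with k ≟ suc m
... | yes _ = sumTo₂ m (λ j → F (suc j) *ₚ inv₂Approx F m (m ∸ j))
... | no  _ = inv₂Approx F m k

inv₂ : Series₂ → Series₂
inv₂ F k = inv₂Approx F k k

inv₂Approx-diag : ∀ F m →
  inv₂Approx F (suc m) (suc m) ≡ sumTo₂ m (λ j → F (suc j) *ₚ inv₂Approx F m (m ∸ j))
inv₂Approx-diag F m with suc m ≟ suc m
... | yes _    = refl
... | no  m≢m = contradiction refl m≢m

inv₂Approx-stable : ∀ F m k → k ≤ m → inv₂Approx F m k ≡ inv₂ F k
inv₂Approx-stable F zero    zero z≤n = refl
inv₂Approx-stable F (suc m) k k≤1+m with k ≟ suc m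
... | yes refl = sym (inv₂Approx-diag F m)
... | no  k≢1+m = inv₂Approx-stable F m k (m<1+n⇒m≤n (≤∧≢⇒< k≤1+m k≢1+m))

inv₂-suc : ∀ F m → inv₂ F (suc m) ≡ sumTo₂ m (λ j → F (suc j) *ₚ inv₂ F (m ∸ j))
inv₂-suc F m = trans (inv₂Approx-diag F m)
  (sumTo₂-cong m (λ j _ → cong (F (suc j) *ₚ_) (inv₂Approx-stable F m (m ∸ j) (m∸n≤m m j))))

⊗₂-inverseʳ : ∀ F → F 0 ≡ 1ℙ → F ⊗₂ inv₂ F ≗ 1₂
⊗₂-inverseʳ F F₀≡1 zero    rewrite F₀≡1 = refl
⊗₂-inverseʳ F F₀≡1 (suc m) = begin
  sumTo₂ (suc m) (λ i → F i *ₚ inv₂ F (suc m ∸ i))  ≡⟨ sumTo₂-unconsˡ m _ ⟩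
  (F 0 *ₚ inv₂ F (suc m)) +ₚ S                      ≡⟨ cong (λ c → (c *ₚ inv₂ F (suc m)) +ₚ S) F₀≡1 ⟩
  inv₂ F (suc m) +ₚ S                               ≡⟨ cong (_+ₚ S) (inv₂-suc F m) ⟩
  S +ₚ S                                            ≡⟨ ℙ.p+p≡0ℙ S ⟩
  0ℙ                                                ∎
  where
  open ≡-Reasoning
  S : Parity
  S = sumTo₂ m (λ j → F (suc j) *ₚ inv₂ F (m ∸ j))

⊗₂-cancelʳ : ∀ D {F G} → D 0 ≡ 1ℙ → F ⊗₂ D ≗ G ⊗₂ D → F ≗ G
⊗₂-cancelʳ D {F} {G} D₀≡1 FD≗GD = begin
  F                          ≈⟨ ⊗₂-identityʳ F ⟨
  F ⊗₂ 1₂                    ≈⟨ ⊗₂-congˡ F (⊗₂-inverseʳ D D₀≡1) ⟨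
  F ⊗₂ (D ⊗₂ inv₂ D)         ≈⟨ ⊗₂-assoc F D (inv₂ D) ⟨
  (F ⊗₂ D) ⊗₂ inv₂ D         ≈⟨ ⊗₂-congʳ (inv₂ D) FD≗GD ⟩
  (G ⊗₂ D) ⊗₂ inv₂ D         ≈⟨ ⊗₂-assoc G D (inv₂ D) ⟩
  G ⊗₂ (D ⊗₂ inv₂ D)         ≈⟨ ⊗₂-congˡ G (⊗₂-inverseʳ D D₀≡1) ⟩
  G ⊗₂ 1₂                    ≈⟨ ⊗₂-identityʳ G ⟩
  G                          ∎
  where open ≗-Reasoning

-- X = x(q⁴) + q·Y(q⁴) for some series x
record QuarterSplit (X Y : Series₂) : Set where
  field
    oddPart≗dilate     : oddPart X ≗ dilate Y
    oddPart-evenPart≗0 : oddPart (evenPart X) ≗ 0₂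

module _ {X Y : Series₂} (splitX : QuarterSplit X Y) (splitY : QuarterSplit Y X) where
  open QuarterSplit
  open ≗-Reasoning

  oddPart-oddPart-⊗₂≗0 : oddPart (oddPart (X ⊗₂ Y)) ≗ 0₂
  oddPart-oddPart-⊗₂≗0 = begin
    oddPart (oddPart (X ⊗₂ Y))
      ≈⟨ oddPart-cong (oddPart-⊗₂ X Y) ⟩
    oddPart (evenPart X ⊗₂ oddPart Y) ⊕₂ oddPart (oddPart X ⊗₂ evenPart Y)
      ≈⟨ ⊕₂-cong (oddPart-cong (⊗₂-comm (evenPart X) (oddPart Y))) (λ _ → refl) ⟩
    oddPart (oddPart Y ⊗₂ evenPart X) ⊕₂ oddPart (oddPart X ⊗₂ evenPart Y)
      ≈⟨ ⊕₂-cong (oddPart-cong (⊗₂-congʳ (evenPart X) (oddPart≗dilate splitY)))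
                 (oddPart-cong (⊗₂-congʳ (evenPart Y) (oddPart≗dilate splitX))) ⟩
    oddPart (dilate X ⊗₂ evenPart X) ⊕₂ oddPart (dilate Y ⊗₂ evenPart Y)
      ≈⟨ ⊕₂-cong (oddPart-dilate-⊗₂ X (evenPart X)) (oddPart-dilate-⊗₂ Y (evenPart Y)) ⟩
    X ⊗₂ oddPart (evenPart X) ⊕₂ Y ⊗₂ oddPart (evenPart Y)
      ≈⟨ ⊕₂-cong (⊗₂-zeroʳ X (oddPart-evenPart≗0 splitX)) (⊗₂-zeroʳ Y (oddPart-evenPart≗0 splitY)) ⟩
    0₂ ∎

  oddPart-evenPart-⊗₂ : oddPart (evenPart (X ⊗₂ Y)) ≗ X ⊗₂ Y
  oddPart-evenPart-⊗₂ = begin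
    oddPart (evenPart (X ⊗₂ Y))
      ≈⟨ oddPart-cong (evenPart-⊗₂ X Y) ⟩
    oddPart (evenPart X ⊗₂ evenPart Y) ⊕₂ evenPart (oddPart X ⊗₂ oddPart Y)
      ≈⟨ ⊕₂-cong (oddPart-⊗₂ (evenPart X) (evenPart Y))
                 (evenPart-cong (⊗₂-cong (oddPart≗dilate splitX) (oddPart≗dilate splitY))) ⟩
    (evenPart (evenPart X) ⊗₂ oddPart (evenPart Y) ⊕₂ oddPart (evenPart X) ⊗₂ evenPart (evenPart Y))
      ⊕₂ evenPart (dilate Y ⊗₂ dilate X)
      ≈⟨ ⊕₂-cong (⊕₂-cong (⊗₂-zeroʳ (evenPart (evenPart X)) (oddPart-evenPart≗0 splitY))
                          (⊗₂-zeroˡ (evenPart (evenPart Y)) (oddPart-evenPart≗0 splitX)))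
                 (evenPart-dilate-⊗₂ Y (dilate X)) ⟩
    Y ⊗₂ evenPart (dilate X)
      ≈⟨ ⊗₂-congˡ Y (evenPart-dilate X) ⟩
    Y ⊗₂ X
      ≈⟨ ⊗₂-comm Y X ⟩
    X ⊗₂ Y ∎

  oddPart-oddPart-⊗₂-⊕₂ : oddPart (oddPart ((X ⊗₂ Y) ⊗₂ (X ⊕₂ Y))) ≗ (X ⊗₂ Y) ⊗₂ (X ⊕₂ Y)
  oddPart-oddPart-⊗₂-⊕₂ = begin
    oddPart (oddPart (C ⊗₂ D))
      ≈⟨ oddPart-cong (oddPart-⊗₂ C D) ⟩
    oddPart (evenPart C ⊗₂ oddPart D) ⊕₂ oddPart (oddPart C ⊗₂ evenPart D)
      ≈⟨ ⊕₂-cong (oddPart-cong (⊗₂-comm (evenPart C) (oddPart D))) (oddPart-⊗₂ (oddPart C) (evenPart D)) ⟩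
    oddPart (oddPart D ⊗₂ evenPart C) ⊕₂
      (evenPart (oddPart C) ⊗₂ oddPart (evenPart D) ⊕₂ oddPart (oddPart C) ⊗₂ evenPart (evenPart D))
      ≈⟨ ⊕₂-cong (oddPart-cong (⊗₂-congʳ (evenPart C) oddPart-D))
                 (⊕₂-cong (⊗₂-zeroʳ (evenPart (oddPart C)) oddPart-evenPart-D)
                          (⊗₂-zeroˡ (evenPart (evenPart D)) oddPart-oddPart-⊗₂≗0)) ⟩
    oddPart (dilate (Y ⊕₂ X) ⊗₂ evenPart C) ⊕₂ 0₂
      ≈⟨ ⊕₂-identityʳ _ ⟩
    oddPart (dilate (Y ⊕₂ X) ⊗₂ evenPart C)
      ≈⟨ oddPart-dilate-⊗₂ (Y ⊕₂ X) (evenPart C) ⟩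
    (Y ⊕₂ X) ⊗₂ oddPart (evenPart C)
      ≈⟨ ⊗₂-cong (⊕₂-comm Y X) oddPart-evenPart-⊗₂ ⟩
    D ⊗₂ C
      ≈⟨ ⊗₂-comm D C ⟩
    C ⊗₂ D ∎
    where
    C D : Series₂
    C = X ⊗₂ Y
    D = X ⊕₂ Y
    oddPart-D : oddPart D ≗ dilate (Y ⊕₂ X)
    oddPart-D = begin
      oddPart X ⊕₂ oddPart Y  ≈⟨ ⊕₂-cong (oddPart≗dilate splitX) (oddPart≗dilate splitY) ⟩
      dilate Y ⊕₂ dilate X    ≈⟨ dilate-⊕₂ Y X ⟨
      dilate (Y ⊕₂ X)         ∎
    oddPart-evenPart-D : oddPart (evenPart D) ≗ 0₂
    oddPart-evenPart-D = ⊕₂-cong (oddPart-evenPart≗0 splitX) (oddPart-evenPart≗0 splitY)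

  oddPart-oddPart-quotient : ∀ F → (X ⊕₂ Y) 0 ≡ 1ℙ →
    F ⊗₂ dilate (dilate (X ⊕₂ Y)) ≗ (X ⊗₂ Y) ⊗₂ (X ⊕₂ Y) → oddPart (oddPart F) ≗ X ⊗₂ Y
  oddPart-oddPart-quotient F D₀≡1 FD⁴≗CD = ⊗₂-cancelʳ D D₀≡1 (begin
    oddPart (oddPart F) ⊗₂ D                       ≈⟨ ⊗₂-comm (oddPart (oddPart F)) D ⟩
    D ⊗₂ oddPart (oddPart F)                       ≈⟨ oddPart-dilate-⊗₂ D (oddPart F) ⟨
    oddPart (dilate D ⊗₂ oddPart F)                ≈⟨ oddPart-cong (oddPart-dilate-⊗₂ (dilate D) F) ⟨
    oddPart (oddPart (dilate (dilate D) ⊗₂ F))     ≈⟨ oddPart-cong (oddPart-cong (⊗₂-comm _ F)) ⟩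
    oddPart (oddPart (F ⊗₂ dilate (dilate D)))     ≈⟨ oddPart-cong (oddPart-cong FD⁴≗CD) ⟩
    oddPart (oddPart ((X ⊗₂ Y) ⊗₂ D))              ≈⟨ oddPart-oddPart-⊗₂-⊕₂ ⟩
    (X ⊗₂ Y) ⊗₂ D                                  ∎)
    where
    D : Series₂
    D = X ⊕₂ Y

-- Lacunary series

sumTo₂-single : ∀ {m n} f → n ≤ m → (∀ i → i ≢ n → f i ≡ 0ℙ) → sumTo₂ m f ≡ f n
sumTo₂-single {zero}  f z≤n others = refl
sumTo₂-single {suc m} {n} f n≤1+m others with m≤n⇒m<n∨m≡n n≤1+m
... | inj₁ n≤m  = trans (cong₂ _+ₚ_ (sumTo₂-single f (m<1+n⇒m≤n n≤m) others) (others (suc m) (>⇒≢ n≤m)))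
                        (ℙ.+-identityʳ (f n))
... | inj₂ refl = cong (_+ₚ f (suc m)) (sumTo₂-0ℙ m f (λ i i≤m → others i (<⇒≢ (s≤s i≤m))))

sumTo₂≡1ℙ⇒∃ : ∀ m f → sumTo₂ m f ≡ 1ℙ → ∃[ i ] f i ≡ 1ℙ
sumTo₂≡1ℙ⇒∃ zero    f eq = 0 , eq
sumTo₂≡1ℙ⇒∃ (suc m) f eq with f (suc m) in fₘ
... | 1ℙ = suc m , fₘ
... | 0ℙ = sumTo₂≡1ℙ⇒∃ m f (trans (sym (ℙ.+-identityʳ (sumTo₂ m f))) eq)

indic₂ : ℕ → ℕ → Parity
indic₂ k m with k ≟ m
... | yes _ = 1ℙ
... | no  _ = 0ℙ

indic₂-≡ : ∀ k → indic₂ k k ≡ 1ℙ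
indic₂-≡ k with k ≟ k
... | yes _   = refl
... | no  k≢k = contradiction refl k≢k

indic₂-≢ : ∀ {k m} → k ≢ m → indic₂ k m ≡ 0ℙ
indic₂-≢ {k} {m} k≢m with k ≟ m
... | yes k≡m = contradiction k≡m k≢m
... | no  _   = refl

indic₂≡1ℙ⇒≡ : ∀ k m → indic₂ k m ≡ 1ℙ → k ≡ m
indic₂≡1ℙ⇒≡ k m eq with k ≟ m
... | yes k≡m = k≡m

-- for ascending g, the series Σ_n q^(g n) modulo 2
imageIndicator : (ℕ → ℕ) → Series₂
imageIndicator g m = sumTo₂ m (λ n → indic₂ (g n) m)

Ascending : (ℕ → ℕ) → Set
Ascending g = ∀ n → g n < g (suc n)

module _ {g : ℕ → ℕ} (ascending : Ascending g) where

  ascending-< : ∀ {m n} → m < n → g m < g n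
  ascending-< {m} {suc n} (s≤s m≤n) with m≤n⇒m<n∨m≡n m≤n
  ... | inj₁ m<n  = <-trans (ascending-< m<n) (ascending n)
  ... | inj₂ refl = ascending m

  ascending-injective : ∀ {m n} → g m ≡ g n → m ≡ n
  ascending-injective {m} {n} gm≡gn with <-cmp m n
  ... | tri< m<n _ _ = contradiction gm≡gn (<⇒≢ (ascending-< m<n))
  ... | tri≈ _ m≡n _ = m≡n
  ... | tri> _ _ n<m = contradiction (sym gm≡gn) (<⇒≢ (ascending-< n<m))

  ascending-inflationary : ∀ n → n ≤ g n
  ascending-inflationary zero    = z≤n
  ascending-inflationary (suc n) = ≤-<-trans (ascending-inflationary n) (ascending n)

  imageIndicator-hit : ∀ {n m} → g n ≡ m → imageIndicator g m ≡ 1ℙ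
  imageIndicator-hit {n} refl = trans
    (sumTo₂-single (λ i → indic₂ (g i) (g n)) (ascending-inflationary n)
                   (λ i i≢n → indic₂-≢ (i≢n ∘ ascending-injective)))
    (indic₂-≡ (g n))

imageIndicator-miss : ∀ g {m} → (∀ n → g n ≢ m) → imageIndicator g m ≡ 0ℙ
imageIndicator-miss g {m} miss = sumTo₂-0ℙ m _ (λ n _ → indic₂-≢ (miss n))

imageIndicator≡1ℙ⇒∃ : ∀ g m → imageIndicator g m ≡ 1ℙ → ∃[ n ] g n ≡ m
imageIndicator≡1ℙ⇒∃ g m eq with n , eqₙ ← sumTo₂≡1ℙ⇒∃ m _ eq = n , indic₂≡1ℙ⇒≡ (g n) m eqₙ

imageIndicator-cong : ∀ {g h m m′} → Ascending g → Ascending h →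
  (∀ {n} → g n ≡ m → ∃[ t ] h t ≡ m′) → (∀ {t} → h t ≡ m′ → ∃[ n ] g n ≡ m) →
  imageIndicator g m ≡ imageIndicator h m′
imageIndicator-cong {g} {h} {m} {m′} asc-g asc-h to from with imageIndicator h m′ in eq
... | 1ℙ = let (t , ht≡m′) = imageIndicator≡1ℙ⇒∃ h m′ eq in imageIndicator-hit asc-g (proj₂ (from ht≡m′))
... | 0ℙ = imageIndicator-miss g (λ n gn≡m →
  let (t , ht≡m′) = to gn≡m in 1ℙ≢0ℙ (trans (sym (imageIndicator-hit asc-h ht≡m′)) eq))
  where
  1ℙ≢0ℙ : 1ℙ ≢ 0ℙ
  1ℙ≢0ℙ ()

double≡2* : ∀ n → double n ≡ 2 * n
double≡2* zero    = refl
double≡2* (suc n) = trans (cong (suc ∘ suc) (double≡2* n)) (sym (*-suc 2 n))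

double-double+ : ∀ j r → r + double (double j) ≡ 4 * j + r
double-double+ j r = begin
  r + double (double j)  ≡⟨ cong (λ x → r + double x) (double≡2* j) ⟩
  r + double (2 * j)     ≡⟨ cong (_+_ r) (double≡2* (2 * j)) ⟩
  r + 2 * (2 * j)        ≡⟨ cong (_+_ r) (sym (*-assoc 2 2 j)) ⟩
  r + 4 * j              ≡⟨ +-comm r (4 * j) ⟩
  4 * j + r              ∎
  where open ≡-Reasoning

residue-4*+ : ∀ x {r} → r < 4 → (4 * x + r) % 4 ≡ r
residue-4*+ x {r} r<4 = begin
  (4 * x + r) % 4  ≡⟨ cong (_% 4) (trans (+-comm (4 * x) r) (cong (_+_ r) (*-comm 4 x))) ⟩
  (r + x * 4) % 4  ≡⟨ [m+kn]%n≡m%n r x 4 ⟩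
  r % 4            ≡⟨ m<n⇒m%n≡m r<4 ⟩
  r                ∎
  where open ≡-Reasoning

residues-≡ : ∀ x y {r s} → r < 4 → s < 4 → 4 * x + r ≡ 4 * y + s → r ≡ s
residues-≡ x y r<4 s<4 eq = trans (sym (residue-4*+ x r<4)) (trans (cong (_% 4) eq) (residue-4*+ y s<4))

quotients-≡ : ∀ x y r → 4 * x + r ≡ 4 * y + r → x ≡ y
quotients-≡ x y r eq = *-cancelˡ-≡ x y 4 (+-cancelʳ-≡ r (4 * x) (4 * y) eq)

module _ {g h : ℕ → ℕ} (ascending-g : Ascending g) (ascending-h : Ascending h)
  (values : ∀ n → (∃[ x ] g n ≡ 4 * x) ⊎ (∃[ t ] g n ≡ 4 * h t + 1))
  (hits : ∀ t → ∃[ n ] g n ≡ 4 * h t + 1)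
  where

  private
    residue≤1 : ∀ n {y s} → s < 4 → g n ≡ 4 * y + s → s ≤ 1
    residue≤1 n {y} s<4 eq with values n
    ... | inj₁ (x , gn≡4x) = subst (_≤ 1)
      (residues-≡ x y (s≤s z≤n) s<4 (trans (+-identityʳ (4 * x)) (trans (sym gn≡4x) eq))) z≤n
    ... | inj₂ (t , gn≡4ht+1) =
      subst (_≤ 1) (residues-≡ (h t) y (s≤s (s≤s z≤n)) s<4 (trans (sym gn≡4ht+1) eq)) ≤-refl

    missing-residue : ∀ j r → 1 < r → r < 4 → imageIndicator g (r + double (double j)) ≡ 0ℙ
    missing-residue j r 1<r r<4 = imageIndicator-miss g λ n gn≡ →
      <⇒≱ 1<r (residue≤1 n {j} r<4 (trans gn≡ (double-double+ j r)))

    residue-1 : ∀ j → imageIndicator g (suc (double (double j))) ≡ imageIndicator h j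
    residue-1 j = imageIndicator-cong ascending-g ascending-h to from
      where
      to : ∀ {n} → g n ≡ suc (double (double j)) → ∃[ t ] h t ≡ j
      to {n} gn≡ with values n | trans gn≡ (double-double+ j 1)
      ... | inj₁ (x , gn≡4x)     | gn≡4j+1 =
        contradiction (residues-≡ x j (s≤s z≤n) (s≤s (s≤s z≤n))
                        (trans (+-identityʳ (4 * x)) (trans (sym gn≡4x) gn≡4j+1))) λ ()
      ... | inj₂ (t , gn≡4ht+1) | gn≡4j+1 = t , quotients-≡ (h t) j 1 (trans (sym gn≡4ht+1) gn≡4j+1)
      from : ∀ {t} → h t ≡ j → ∃[ n ] g n ≡ suc (double (double j))
      from {t} refl with n , gn≡ ← hits t = n , trans gn≡ (sym (double-double+ (h t) 1))

  quarterSplit-imageIndicator : QuarterSplit (imageIndicator g) (imageIndicator h)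
  quarterSplit-imageIndicator = record
    { oddPart≗dilate     = ≗-byParts
        (λ j → trans (residue-1 j) (sym (evenPart-dilate (imageIndicator h) j)))
        (λ j → trans (missing-residue j 3 (s≤s (s≤s z≤n)) ≤-refl)
                     (sym (oddPart-dilate (imageIndicator h) j)))
    ; oddPart-evenPart≗0 = λ j → missing-residue j 2 ≤-refl (s≤s (s≤s (s≤s z≤n)))
    }

-- The series A and B modulo 2

exponentA exponentB : ℕ → ℕ
exponentA n = 3 * n * n + 2 * n
exponentB t = 3 * t * t + 4 * t + 1

exponentA-ascending : Ascending exponentA
exponentA-ascending n = subst (exponentA n <_) (sym (step n)) (s≤s (m≤m+n (exponentA n) (6 * n + 4)))
  where
  step : ∀ n → 3 * suc n * suc n + 2 * suc n ≡ suc (3 * n * n + 2 * n + (6 * n + 4))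
  step = solve-∀

exponentB-ascending : Ascending exponentB
exponentB-ascending n = subst (exponentB n <_) (sym (step n)) (s≤s (m≤m+n (exponentB n) (6 * n + 6)))
  where
  step : ∀ n → 3 * suc n * suc n + 4 * suc n + 1 ≡ suc (3 * n * n + 4 * n + 1 + (6 * n + 6))
  step = solve-∀

even-or-odd : ∀ n → (∃[ s ] n ≡ 2 * s) ⊎ (∃[ s ] n ≡ 1 + 2 * s)
even-or-odd zero = inj₁ (0 , refl)
even-or-odd (suc n) with even-or-odd n
... | inj₁ (s , refl) = inj₂ (s , refl)
... | inj₂ (s , refl) = inj₁ (suc s , cong suc (sym (+-suc s (s + 0))))

exponentA-even : ∀ s → exponentA (2 * s) ≡ 4 * (3 * s * s + s)
exponentA-even = identity
  where
  identity : ∀ s → 3 * (2 * s) * (2 * s) + 2 * (2 * s) ≡ 4 * (3 * s * s + s)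
  identity = solve-∀

exponentA-odd : ∀ s → exponentA (1 + 2 * s) ≡ 4 * exponentB s + 1
exponentA-odd = identity
  where
  identity : ∀ s → 3 * (1 + 2 * s) * (1 + 2 * s) + 2 * (1 + 2 * s) ≡ 4 * (3 * s * s + 4 * s + 1) + 1
  identity = solve-∀

exponentB-even : ∀ s → exponentB (2 * s) ≡ 4 * exponentA s + 1
exponentB-even = identity
  where
  identity : ∀ s → 3 * (2 * s) * (2 * s) + 4 * (2 * s) + 1 ≡ 4 * (3 * s * s + 2 * s) + 1
  identity = solve-∀

exponentB-odd : ∀ s → exponentB (1 + 2 * s) ≡ 4 * (3 * s * s + 5 * s + 2)
exponentB-odd = identity
  where
  identity : ∀ s → 3 * (1 + 2 * s) * (1 + 2 * s) + 4 * (1 + 2 * s) + 1 ≡ 4 * (3 * s * s + 5 * s + 2)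
  identity = solve-∀

exponentA-values : ∀ n → (∃[ x ] exponentA n ≡ 4 * x) ⊎ (∃[ t ] exponentA n ≡ 4 * exponentB t + 1)
exponentA-values n with even-or-odd n
... | inj₁ (s , refl) = inj₁ (3 * s * s + s , exponentA-even s)
... | inj₂ (s , refl) = inj₂ (s , exponentA-odd s)

exponentB-values : ∀ n → (∃[ x ] exponentB n ≡ 4 * x) ⊎ (∃[ t ] exponentB n ≡ 4 * exponentA t + 1)
exponentB-values n with even-or-odd n
... | inj₁ (s , refl) = inj₂ (s , exponentB-even s)
... | inj₂ (s , refl) = inj₁ (3 * s * s + 5 * s + 2 , exponentB-odd s)

A₂ B₂ : Series₂
A₂ = imageIndicator exponentA
B₂ = imageIndicator exponentB

quarterSplit-A₂ : QuarterSplit A₂ B₂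
quarterSplit-A₂ = quarterSplit-imageIndicator exponentA-ascending exponentB-ascending
  exponentA-values (λ t → 1 + 2 * t , exponentA-odd t)

quarterSplit-B₂ : QuarterSplit B₂ A₂
quarterSplit-B₂ = quarterSplit-imageIndicator exponentB-ascending exponentA-ascending
  exponentB-values (λ t → 2 * t , exponentB-even t)

-- Reduction modulo 2

infix 4 _≅₂_

record _≅₂_ (f : Series) (F : Series₂) : Set where
  constructor reduces
  field coefficient : ∀ m → parityℤ (f m) ≡ F m
open _≅₂_

parityℤ-sumTo : ∀ m f → parityℤ (sumTo m f) ≡ sumTo₂ m (parityℤ ∘ f)
parityℤ-sumTo zero    f = refl
parityℤ-sumTo (suc m) f =
  trans (parityℤ-+ (sumTo m f) (f (suc m))) (cong (_+ₚ parityℤ (f (suc m))) (parityℤ-sumTo m f))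

≅₂-⊕ : ∀ {f g F G} → f ≅₂ F → g ≅₂ G → f ⊕ g ≅₂ F ⊕₂ G
≅₂-⊕ {f} {g} f≅F g≅G = reduces λ m →
  trans (parityℤ-+ (f m) (g m)) (cong₂ _+ₚ_ (coefficient f≅F m) (coefficient g≅G m))

≅₂-⊗ : ∀ {f g F G} → f ≅₂ F → g ≅₂ G → f ⊗ g ≅₂ F ⊗₂ G
≅₂-⊗ {f} {g} f≅F g≅G = reduces λ m → trans (parityℤ-sumTo m _) (sumTo₂-cong m λ i _ →
  trans (parityℤ-* (f i) (g (m ∸ i))) (cong₂ _*ₚ_ (coefficient f≅F i) (coefficient g≅G (m ∸ i))))

≅₂-invApprox : ∀ {f F} → f ≅₂ F → ∀ m k → parityℤ (invApprox f m k) ≡ inv₂Approx F m k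
≅₂-invApprox f≅F zero k with k ≟ 0
... | yes _ = refl
... | no  _ = refl
≅₂-invApprox {f} f≅F (suc m) k with k ≟ suc m
... | yes _ = begin
  parityℤ (ℤ.- sumTo m (λ j → f (suc j) ℤ.* invApprox f m (m ∸ j)))
    ≡⟨ parityℤ-neg (sumTo m (λ j → f (suc j) ℤ.* invApprox f m (m ∸ j))) ⟩
  parityℤ (sumTo m (λ j → f (suc j) ℤ.* invApprox f m (m ∸ j)))
    ≡⟨ parityℤ-sumTo m _ ⟩
  sumTo₂ m (λ j → parityℤ (f (suc j) ℤ.* invApprox f m (m ∸ j)))
    ≡⟨ sumTo₂-cong m (λ j _ → trans (parityℤ-* (f (suc j)) _) (cong₂ _*ₚ_
         (coefficient f≅F (suc j)) (≅₂-invApprox f≅F m (m ∸ j)))) ⟩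
  _ ∎
  where open ≡-Reasoning
... | no  _ = ≅₂-invApprox f≅F m k

≅₂-inv : ∀ {f F} → f ≅₂ F → inv f ≅₂ inv₂ F
≅₂-inv f≅F = reduces λ k → ≅₂-invApprox f≅F k k

parityℤ-signPow : ∀ k → parityℤ (signPow k) ≡ 1ℙ
parityℤ-signPow k with k % 2 ≟ 0
... | yes _ = refl
... | no  _ = refl

parityℤ-indic-signPow : ∀ k m e → parityℤ (indic k m (signPow e)) ≡ indic₂ k m
parityℤ-indic-signPow k m e with k ≟ m
... | yes _ = parityℤ-signPow e
... | no  _ = refl

A≅₂A₂ : A ≅₂ A₂
A≅₂A₂ = reduces λ m → trans (parityℤ-sumTo m _)
  (sumTo₂-cong m (λ n _ → parityℤ-indic-signPow (exponentA n) m ((n * suc n) / 2)))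

B≅₂B₂ : B ≅₂ B₂
B≅₂B₂ = reduces λ m → trans (parityℤ-sumTo m _) (sumTo₂-cong m (λ k _ →
  trans (parityℤ-indic-signPow _ m ((suc k * k) / 2)) (cong (λ e → indic₂ e m) (exponent k))))
  where
  exponent : ∀ k → 3 * suc k * suc k ∸ 2 * suc k ≡ exponentB k
  exponent k = trans (cong (_∸ 2 * suc k) (split k)) (m+n∸n≡m (exponentB k) (2 * suc k))
    where
    split : ∀ k → 3 * suc k * suc k ≡ (3 * k * k + 4 * k + 1) + 2 * suc k
    split = solve-∀

-- The congruences

D₂ C₂ b₂ : Series₂
D₂ = A₂ ⊕₂ B₂
C₂ = A₂ ⊗₂ B₂
b₂ = (A₂ ⊗₂ A₂ ⊗₂ B₂ ⊕₂ A₂ ⊗₂ B₂ ⊗₂ B₂) ⊗₂ inv₂ (D₂ ⊗₂ D₂ ⊗₂ D₂ ⊗₂ D₂)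

b₃≅₂b₂ : b₃ ≅₂ b₂
b₃≅₂b₂ = ≅₂-⊗ (≅₂-⊕ (≅₂-⊗ (≅₂-⊗ A≅₂A₂ A≅₂A₂) B≅₂B₂) (≅₂-⊗ (≅₂-⊗ A≅₂A₂ B≅₂B₂) B≅₂B₂))
              (≅₂-inv (≅₂-⊗ (≅₂-⊗ (≅₂-⊗ D≅₂D₂ D≅₂D₂) D≅₂D₂) D≅₂D₂))
  where
  D≅₂D₂ : A ⊕ B ≅₂ D₂
  D≅₂D₂ = ≅₂-⊕ A≅₂A₂ B≅₂B₂

b₂-⊗₂-dilate : b₂ ⊗₂ dilate (dilate D₂) ≗ C₂ ⊗₂ D₂
b₂-⊗₂-dilate = begin
  (N ⊗₂ inv₂ D⁴) ⊗₂ dilate (dilate D₂)  ≈⟨ ⊗₂-congˡ (N ⊗₂ inv₂ D⁴) (⊗₂-fourth-power D₂) ⟨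
  (N ⊗₂ inv₂ D⁴) ⊗₂ D⁴                  ≈⟨ ⊗₂-assoc N (inv₂ D⁴) D⁴ ⟩
  N ⊗₂ (inv₂ D⁴ ⊗₂ D⁴)                  ≈⟨ ⊗₂-congˡ N (⊗₂-comm (inv₂ D⁴) D⁴) ⟩
  N ⊗₂ (D⁴ ⊗₂ inv₂ D⁴)                  ≈⟨ ⊗₂-congˡ N (⊗₂-inverseʳ D⁴ refl) ⟩
  N ⊗₂ 1₂                               ≈⟨ ⊗₂-identityʳ N ⟩
  N                                     ≈⟨ x²y+xy²≗xy[x+y] A₂ B₂ ⟩
  C₂ ⊗₂ D₂                              ∎
  where
  open ≗-Reasoning
  N D⁴ : Series₂
  N  = A₂ ⊗₂ A₂ ⊗₂ B₂ ⊕₂ A₂ ⊗₂ B₂ ⊗₂ B₂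
  D⁴ = D₂ ⊗₂ D₂ ⊗₂ D₂ ⊗₂ D₂

oddPart-oddPart-b₂ : oddPart (oddPart b₂) ≗ C₂
oddPart-oddPart-b₂ = oddPart-oddPart-quotient quarterSplit-A₂ quarterSplit-B₂ b₂ refl b₂-⊗₂-dilate

b₃-even : ∀ m → C₂ m ≡ 0ℙ → (+ 2) ∣ b₃ (4 * m + 3)
b₃-even m C₂m≡0 = parity≡0ℙ⇒2∣ ∣ b₃ (4 * m + 3) ∣ (begin
  parityℤ (b₃ (4 * m + 3))  ≡⟨ coefficient b₃≅₂b₂ (4 * m + 3) ⟩
  b₂ (4 * m + 3)            ≡⟨ cong b₂ (double-double+ m 3) ⟨
  oddPart (oddPart b₂) m    ≡⟨ oddPart-oddPart-b₂ m ⟩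
  C₂ m                      ≡⟨ C₂m≡0 ⟩
  0ℙ                        ∎)
  where open ≡-Reasoning

C₂-4m+3 : ∀ m → C₂ (4 * m + 3) ≡ 0ℙ
C₂-4m+3 m = trans (cong C₂ (sym (double-double+ m 3)))
                  (oddPart-oddPart-⊗₂≗0 quarterSplit-A₂ quarterSplit-B₂ m)

C₂-4m+2 : ∀ m → C₂ (4 * m + 2) ≡ C₂ m
C₂-4m+2 m = trans (cong C₂ (sym (double-double+ m 2)))
                  (oddPart-evenPart-⊗₂ quarterSplit-A₂ quarterSplit-B₂ m)

lemma2p3 : (n : ℕ) →
    ((+ 2) ∣ b₃ (16 * n + 15)) × ((+ 2) ∣ b₃ (64 * n + 59)) × ((+ 2) ∣ b₃ (256 * n + 235))
lemma2p3 n =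
  subst (λ k → (+ 2) ∣ b₃ k) (index₁ n) (b₃-even m₁ C₂m₁≡0) ,
  subst (λ k → (+ 2) ∣ b₃ k) (index₂ n) (b₃-even m₂ C₂m₂≡0) ,
  subst (λ k → (+ 2) ∣ b₃ k) (index₃ n) (b₃-even m₃ (trans (C₂-4m+2 m₂) C₂m₂≡0))
  where
  m₁ m₂ m₃ : ℕ
  m₁ = 4 * n + 3
  m₂ = 4 * m₁ + 2
  m₃ = 4 * m₂ + 2
  C₂m₁≡0 : C₂ m₁ ≡ 0ℙ
  C₂m₁≡0 = C₂-4m+3 n
  C₂m₂≡0 : C₂ m₂ ≡ 0ℙ
  C₂m₂≡0 = trans (C₂-4m+2 m₁) C₂m₁≡0
  index₁ : ∀ n → 4 * (4 * n + 3) + 3 ≡ 16 * n + 15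
  index₁ = solve-∀
  index₂ : ∀ n → 4 * (4 * (4 * n + 3) + 2) + 3 ≡ 64 * n + 59
  index₂ = solve-∀
  index₃ : ∀ n → 4 * (4 * (4 * (4 * n + 3) + 2) + 2) + 3 ≡ 256 * n + 235
  index₃ = solve-∀
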